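{- The infinite hexagonal grid (the graph formed by the vertices and edges of the tessellation of the plane by regular hexagons, i.e. the honeycomb lattice, in which every vertex has degree $3$ and lies on exactly three hexagons) is efficiently dominatable.
   Context: For a graph $G$ and vertex $v$, $N[v]$ denotes the closed neighborhood of $v$ ($v$ together with its neighbors). A graph $G$ is efficiently dominatable if there is a set $S\subseteq V(G)$ with $|N[v]\cap S|=1$ for every $v\in V(G)$ (an efficient dominating set). -}

module Defs where

open import Level using (0ℓ)
open import Data.Integer using (ℤ; +_; _+_; _-_; 1ℤ)
open import Data.Product using (Σ; ∃; _×_; _,_)
open import Data.Sum using (_⊎_)
open import Data.Empty using (⊥)
open import Relation.Binary.PropositionalEquality using (_≡_)
open import Relation.Nullary using (¬_)

record Graph : Set₁ where
  field
    V     : Set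
    Adj   : V → V → Set
    irrefl : ∀ v → ¬ Adj v v
    sym   : ∀ u v → Adj u v → Adj v u

open Graph public

N[_] : (G : Graph) → V G → V G → Set
N[ G ] v u = (u ≡ v) ⊎ Adj G v u

IsEfficientDominatingSet : (G : Graph) → (V G → Set) → Set
IsEfficientDominatingSet G S =
  ∀ v → Σ (V G) λ u → (N[ G ] v u × S u) ×
        (∀ w → N[ G ] v w → S w → w ≡ u)

EfficientlyDominatable : Graph → Set₁
EfficientlyDominatable G = Σ (V G → Set) λ S → IsEfficientDominatingSet G S

data Even : ℤ → Set where
  even : ∀ k → Even (k + k)

-- The infinite hexagonal grid (honeycomb lattice) in its standard
-- "brick wall" coordinates: vertices are ℤ × ℤ; (x , y) is adjacent to
-- (x ± 1 , y), and additionally to (x , y + 1) when x + y is even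
-- (equivalently, (x , y) and (x , y + 1) are adjacent iff x + y is even).
-- Every vertex has degree 3 and the faces are hexagons (bricks of width 2).
data HexAdj : ℤ × ℤ → ℤ × ℤ → Set where
  right : ∀ x y → HexAdj (x , y) (x + 1ℤ , y)
  left  : ∀ x y → HexAdj (x , y) (x - 1ℤ , y)
  up    : ∀ x y → Even (x + y) → HexAdj (x , y) (x , y + 1ℤ)
  down  : ∀ x y → Even (x + (y - 1ℤ)) → HexAdj (x , y) (x , y - 1ℤ)

private
  module HexProofs where
    open import Data.Integer.Properties as ℤP using ()
    open import Relation.Binary.PropositionalEquality as Eq using (refl; cong; subst; _≢_)
    open import Data.Product using (proj₁)
    open import Data.Integer using (-_; 0ℤ; -1ℤ)

    i+a-a : ∀ i a → (i + a) - a ≡ i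
    i+a-a i a = Eq.trans (ℤP.+-assoc i a (- a))
                 (Eq.trans (cong (λ z → i + z) (ℤP.+-inverseʳ a)) (ℤP.+-identityʳ i))

    i-a+a : ∀ i a → (i - a) + a ≡ i
    i-a+a i a = Eq.trans (ℤP.+-assoc i (- a) a)
                 (Eq.trans (cong (λ z → i + z) (ℤP.+-inverseˡ a)) (ℤP.+-identityʳ i))

    i≢i+a : ∀ i a → a ≢ 0ℤ → i ≢ i + a
    i≢i+a i a a≢0 eq = a≢0 (Eq.trans (Eq.sym (ℤP.+-identityˡ a))
      (Eq.trans (cong (_+ a) (Eq.sym (ℤP.+-inverseˡ i)))
        (Eq.trans (ℤP.+-assoc (- i) i a)
          (Eq.trans (cong (λ z → (- i) + z) (Eq.sym eq)) (ℤP.+-inverseˡ i)))))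

    1≢0 : 1ℤ ≢ 0ℤ
    1≢0 ()
    -1≢0 : -1ℤ ≢ 0ℤ
    -1≢0 ()

    hexIrrefl : ∀ v → ¬ HexAdj v v
    hexIrrefl (x , y) a = go a refl
      where
      go : ∀ {u w} → HexAdj u w → u ≡ w → ⊥
      go (right x y) e = i≢i+a x 1ℤ 1≢0 (cong Data.Product.proj₁ e)
      go (left x y) e = i≢i+a x -1ℤ -1≢0 (cong Data.Product.proj₁ e)
      go (up x y _) e = i≢i+a y 1ℤ 1≢0 (cong Data.Product.proj₂ e)
      go (down x y _) e = i≢i+a y -1ℤ -1≢0 (cong Data.Product.proj₂ e)

    hexSym : ∀ u v → HexAdj u v → HexAdj v u
    hexSym _ _ (right x y) = subst (λ z → HexAdj (x + 1ℤ , y) (z , y)) (i+a-a x 1ℤ) (left (x + 1ℤ) y)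
    hexSym _ _ (left x y) = subst (λ z → HexAdj (x - 1ℤ , y) (z , y)) (i-a+a x 1ℤ) (right (x - 1ℤ) y)
    hexSym _ _ (up x y e) = subst (λ z → HexAdj (x , y + 1ℤ) (x , z)) (i+a-a y 1ℤ)
      (down x (y + 1ℤ) (subst (λ z → Even (x + z)) (Eq.sym (i+a-a y 1ℤ)) e))
    hexSym _ _ (down x y e) = subst (λ z → HexAdj (x , y - 1ℤ) (x , z)) (i-a+a y 1ℤ) (up x (y - 1ℤ) e)

HexGrid : Graph
HexGrid = record
  { V = ℤ × ℤ
  ; Adj = HexAdj
  ; irrefl = HexProofs.hexIrrefl
  ; sym = HexProofs.hexSym
  }

-- Colour the vertex (x , y) by x + 2y modulo 4. Moving right, left or along the
-- single vertical edge at a vertex changes its colour by +1, −1 and ±2 ≡ 2, so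
-- every closed neighbourhood carries each of the four colours exactly once, and
-- hence any colour class is an efficient dominating set.

module Submission where

open import Data.Fin using (Fin; toℕ; fromℕ<)
open import Data.Fin.Patterns using (0F; 1F; 2F; 3F)
open import Data.Fin.Properties using (_≟_; all?)
open import Data.Integer using (ℤ; +_; -[1+_]; _+_; _-_; _*_; 1ℤ; -1ℤ)
open import Data.Integer.DivMod using (_%_; _/_; a≡a%n+[a/n]*n; n%d<d)
open import Data.Integer.Divisibility.Signed using (_∣_; divides; ∣m∣n⇒∣m-n; ∣⇒∣ᵤ)
open import Data.Integer.Properties using (+-assoc)
open import Data.Integer.Tactic.RingSolver using (solve-∀)
open import Data.Nat as ℕ using (ℕ; zero; suc)
open import Data.Nat.DivMod using (m%n<n)
open import Data.Nat.Divisibility using (∣1⇒≡1)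
open import Data.Nat.Properties using (+-comm)
open import Data.Product using (Σ; _×_; _,_)
open import Data.Sum using (_⊎_; inj₁; inj₂)
open import Data.Empty using (⊥; ⊥-elim)
open import Relation.Nullary.Decidable using (from-yes; _→-dec_)
open import Relation.Binary.PropositionalEquality
open ≡-Reasoning

open import Defs hiding (sym)

module _ (G : Graph) {C : Set} (colour : V G → C) where

  ColourInjectiveOnNeighbourhoods : Set
  ColourInjectiveOnNeighbourhoods =
    ∀ v {u w} → N[ G ] v u → N[ G ] v w → colour u ≡ colour w → u ≡ w

  fibre-isEfficientDominatingSet :
    ColourInjectiveOnNeighbourhoods → ∀ c →
    (∀ v → Σ (V G) λ u → N[ G ] v u × colour u ≡ c) →
    IsEfficientDominatingSet G (λ u → colour u ≡ c)
  fibre-isEfficientDominatingSet injective c meets v with meets v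
  ... | u , u∈N[v] , u↦c =
    u , (u∈N[v] , u↦c) , λ w w∈N[v] w↦c → injective v w∈N[v] u∈N[v] (trans w↦c (sym u↦c))

ℤ₄ : Set
ℤ₄ = Fin 4

infixl 6 _+₄_ _-₄_

_+₄_ : ℤ₄ → ℤ₄ → ℤ₄
a +₄ b = fromℕ< (m%n<n (toℕ a ℕ.+ toℕ b) 4)

_-₄_ : ℤ₄ → ℤ₄ → ℤ₄
a -₄ b = fromℕ< (m%n<n (toℕ a ℕ.+ (4 ℕ.∸ toℕ b)) 4)

+₄-identityʳ : ∀ a → a +₄ 0F ≡ a
+₄-identityʳ = from-yes (all? λ a → a +₄ 0F ≟ a)

+₄-assoc : ∀ a b c → (a +₄ b) +₄ c ≡ a +₄ (b +₄ c)
+₄-assoc = from-yes (all? λ a → all? λ b → all? λ c → (a +₄ b) +₄ c ≟ a +₄ (b +₄ c))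

+₄-cancelˡ : ∀ a b c → a +₄ b ≡ a +₄ c → b ≡ c
+₄-cancelˡ = from-yes (all? λ a → all? λ b → all? λ c → (a +₄ b ≟ a +₄ c) →-dec (b ≟ c))

a+[b-a]≡b : ∀ a b → a +₄ (b -₄ a) ≡ b
a+[b-a]≡b = from-yes (all? λ a → all? λ b → a +₄ (b -₄ a) ≟ b)

fromℕ₄ : ℕ → ℤ₄
fromℕ₄ zero = 0F
fromℕ₄ (suc n) = fromℕ₄ n +₄ 1F

fromNegSuc₄ : ℕ → ℤ₄
fromNegSuc₄ zero = 3F
fromNegSuc₄ (suc n) = fromNegSuc₄ n +₄ 3F

fromℤ : ℤ → ℤ₄
fromℤ (+ n) = fromℕ₄ n
fromℤ -[1+ n ] = fromNegSuc₄ n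

fromℤ-+1 : ∀ z → fromℤ (z + 1ℤ) ≡ fromℤ z +₄ 1F
fromℤ-+1 (+ n) rewrite +-comm n 1 = refl
fromℤ-+1 -[1+ zero ] = refl
fromℤ-+1 -[1+ suc n ] = begin
  fromNegSuc₄ n                ≡⟨ sym (+₄-identityʳ (fromNegSuc₄ n)) ⟩
  fromNegSuc₄ n +₄ (3F +₄ 1F)  ≡⟨ sym (+₄-assoc (fromNegSuc₄ n) 3F 1F) ⟩
  fromNegSuc₄ n +₄ 3F +₄ 1F    ∎

fromℤ--1 : ∀ z → fromℤ (z - 1ℤ) ≡ fromℤ z +₄ 3F
fromℤ--1 z = begin
  fromℤ (z - 1ℤ)                ≡⟨ sym (+₄-identityʳ (fromℤ (z - 1ℤ))) ⟩
  fromℤ (z - 1ℤ) +₄ (1F +₄ 3F)  ≡⟨ sym (+₄-assoc (fromℤ (z - 1ℤ)) 1F 3F) ⟩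
  fromℤ (z - 1ℤ) +₄ 1F +₄ 3F    ≡⟨ cong (_+₄ 3F) (sym (fromℤ-+1 (z - 1ℤ))) ⟩
  fromℤ (z - 1ℤ + 1ℤ) +₄ 3F     ≡⟨ cong (λ t → fromℤ t +₄ 3F) (z-1+1≡z z) ⟩
  fromℤ z +₄ 3F                 ∎
  where
  z-1+1≡z : ∀ z → z - 1ℤ + 1ℤ ≡ z
  z-1+1≡z = solve-∀

fromℤ-+2 : ∀ z → fromℤ (z + 1ℤ + 1ℤ) ≡ fromℤ z +₄ 2F
fromℤ-+2 z = begin
  fromℤ (z + 1ℤ + 1ℤ)   ≡⟨ fromℤ-+1 (z + 1ℤ) ⟩
  fromℤ (z + 1ℤ) +₄ 1F  ≡⟨ cong (_+₄ 1F) (fromℤ-+1 z) ⟩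
  fromℤ z +₄ 1F +₄ 1F   ≡⟨ +₄-assoc (fromℤ z) 1F 1F ⟩
  fromℤ z +₄ 2F         ∎

fromℤ--2 : ∀ z → fromℤ (z - 1ℤ - 1ℤ) ≡ fromℤ z +₄ 2F
fromℤ--2 z = begin
  fromℤ (z - 1ℤ - 1ℤ)   ≡⟨ fromℤ--1 (z - 1ℤ) ⟩
  fromℤ (z - 1ℤ) +₄ 3F  ≡⟨ cong (_+₄ 3F) (fromℤ--1 z) ⟩
  fromℤ z +₄ 3F +₄ 3F   ≡⟨ +₄-assoc (fromℤ z) 3F 3F ⟩
  fromℤ z +₄ 2F         ∎

even-or-odd : ∀ z → Even z ⊎ Even (z - 1ℤ)
even-or-odd z with z % + 2 | a≡a%n+[a/n]*n z (+ 2) | n%d<d z (+ 2)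
... | 0 | z≡0+2q | _ =
  inj₁ (subst Even (sym (trans z≡0+2q (0+q*2≡q+q (z / + 2)))) (even (z / + 2)))
  where
  0+q*2≡q+q : ∀ q → + 0 + q * + 2 ≡ q + q
  0+q*2≡q+q = solve-∀
... | 1 | z≡1+2q | _ =
  inj₂ (subst Even (sym (trans (cong (_- 1ℤ) z≡1+2q) (1+q*2-1≡q+q (z / + 2)))) (even (z / + 2)))
  where
  1+q*2-1≡q+q : ∀ q → + 1 + q * + 2 - 1ℤ ≡ q + q
  1+q*2-1≡q+q = solve-∀
... | suc (suc _) | _ | ℕ.s≤s (ℕ.s≤s ())

even-odd-disjoint : ∀ {z} → Even z → Even (z - 1ℤ) → ⊥
even-odd-disjoint {z} e o =
  2≢1 (∣1⇒≡1 (∣⇒∣ᵤ (subst (+ 2 ∣_) (z-[z-1]≡1 z) (∣m∣n⇒∣m-n (2∣ e) (2∣ o)))))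
  where
  2∣ : ∀ {n} → Even n → + 2 ∣ n
  2∣ (even k) = divides k (k+k≡k*2 k)
    where
    k+k≡k*2 : ∀ k → k + k ≡ k * + 2
    k+k≡k*2 = solve-∀
  z-[z-1]≡1 : ∀ z → z - (z - 1ℤ) ≡ 1ℤ
  z-[z-1]≡1 = solve-∀
  2≢1 : 2 ≢ 1
  2≢1 ()

colour : ℤ × ℤ → ℤ₄
colour (x , y) = fromℤ (x + (y + y))

offset : ∀ {v u} → N[ HexGrid ] v u → ℤ₄
offset (inj₁ _) = 0F
offset (inj₂ (right _ _)) = 1F
offset (inj₂ (left _ _)) = 3F
offset (inj₂ (up _ _ _)) = 2F
offset (inj₂ (down _ _ _)) = 2F

colour-offset : ∀ {v u} (p : N[ HexGrid ] v u) → colour u ≡ colour v +₄ offset p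
colour-offset (inj₁ refl) = sym (+₄-identityʳ _)
colour-offset (inj₂ (right x y)) = trans (cong fromℤ (shift x y)) (fromℤ-+1 (x + (y + y)))
  where
  shift : ∀ x y → x + 1ℤ + (y + y) ≡ x + (y + y) + 1ℤ
  shift = solve-∀
colour-offset (inj₂ (left x y)) = trans (cong fromℤ (shift x y)) (fromℤ--1 (x + (y + y)))
  where
  shift : ∀ x y → x - 1ℤ + (y + y) ≡ x + (y + y) - 1ℤ
  shift = solve-∀
colour-offset (inj₂ (up x y _)) = trans (cong fromℤ (shift x y)) (fromℤ-+2 (x + (y + y)))
  where
  shift : ∀ x y → x + (y + 1ℤ + (y + 1ℤ)) ≡ x + (y + y) + 1ℤ + 1ℤ
  shift = solve-∀
colour-offset (inj₂ (down x y _)) = trans (cong fromℤ (shift x y)) (fromℤ--2 (x + (y + y)))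
  where
  shift : ∀ x y → x + (y - 1ℤ + (y - 1ℤ)) ≡ x + (y + y) - 1ℤ - 1ℤ
  shift = solve-∀

vertical : ∀ x y → Even (x + y) ⊎ Even (x + y - 1ℤ) → ℤ × ℤ
vertical x y (inj₁ _) = x , y + 1ℤ
vertical x y (inj₂ _) = x , y - 1ℤ

step : ℤ × ℤ → ℤ₄ → ℤ × ℤ
step v 0F = v
step (x , y) 1F = x + 1ℤ , y
step (x , y) 2F = vertical x y (even-or-odd (x + y))
step (x , y) 3F = x - 1ℤ , y

step-offset : ∀ {v u} (p : N[ HexGrid ] v u) → step v (offset p) ≡ u
step-offset (inj₁ refl) = refl
step-offset (inj₂ (right x y)) = refl
step-offset (inj₂ (left x y)) = refl
step-offset (inj₂ (up x y e)) with even-or-odd (x + y)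
... | inj₁ _ = refl
... | inj₂ o = ⊥-elim (even-odd-disjoint e o)
step-offset (inj₂ (down x y o)) with even-or-odd (x + y)
... | inj₁ e = ⊥-elim (even-odd-disjoint e (subst Even (sym (+-assoc x y -1ℤ)) o))
... | inj₂ _ = refl

step-neighbour : ∀ v d → Σ (N[ HexGrid ] v (step v d)) λ p → offset p ≡ d
step-neighbour v 0F = inj₁ refl , refl
step-neighbour (x , y) 1F = inj₂ (right x y) , refl
step-neighbour (x , y) 2F with even-or-odd (x + y)
... | inj₁ e = inj₂ (up x y e) , refl
... | inj₂ o = inj₂ (down x y (subst Even (+-assoc x y -1ℤ) o)) , refl
step-neighbour (x , y) 3F = inj₂ (left x y) , refl

colour-injective : ColourInjectiveOnNeighbourhoods HexGrid colour
colour-injective v {u} {w} p q same = begin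
  u                 ≡⟨ sym (step-offset p) ⟩
  step v (offset p) ≡⟨ cong (step v) (+₄-cancelˡ (colour v) (offset p) (offset q) colours) ⟩
  step v (offset q) ≡⟨ step-offset q ⟩
  w                 ∎
  where
  colours : colour v +₄ offset p ≡ colour v +₄ offset q
  colours = trans (sym (colour-offset p)) (trans same (colour-offset q))

neighbourhood-rainbow : ∀ v c → Σ (ℤ × ℤ) λ u → N[ HexGrid ] v u × colour u ≡ c
neighbourhood-rainbow v c with step-neighbour v (c -₄ colour v)
... | p , offset≡ = step v (c -₄ colour v) , p , (begin
  colour (step v (c -₄ colour v)) ≡⟨ colour-offset p ⟩
  colour v +₄ offset p            ≡⟨ cong (colour v +₄_) offset≡ ⟩
  colour v +₄ (c -₄ colour v)     ≡⟨ a+[b-a]≡b (colour v) c ⟩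
  c                               ∎)

mainTheorem10 : EfficientlyDominatable HexGrid
mainTheorem10 =
  (λ u → colour u ≡ 0F) ,
  fibre-isEfficientDominatingSet HexGrid colour colour-injective 0F (λ v → neighbourhood-rainbow v 0F)
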